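{- Suppose $\Gamma \vdash_{\mathsf{NK}} A$. (1) If $A$ and the formulas in $\Gamma$ do not contain any occurrence of $\forall$, then there exists a $\mathsf{j}$-standard derivation $\Pi' \colon \Gamma \vdash A$ in $\mathsf{NK}$. (2) If $A$ and the formulas in $\Gamma$ do not contain any occurrence of $\forall$ nor of $\to$, then there exists an $\mathsf{m}$-standard derivation $\Pi' \colon \Gamma \vdash A$ in $\mathsf{NK}$.
   Context: Setting: first-order natural deduction with connectives $\top,\bot,\lnot,\land,\lor,\to,\forall,\exists$, where $\lnot$ is primitive (not an abbreviation of $A\to\bot$), with its own rules $\lnot_\mathsf{i}$ (from a derivation of $\bot$ from assumptions $A$, infer $\lnot A$, discharging $A$) and $\lnot_\mathsf{e}$ (from $\lnot A$ and $A$ infer $\bot$). $\mathsf{NM}$ (first-order minimal natural deduction) consists of the standard introduction and elimination rules for $\top,\lnot,\land,\lor,\to,\forall,\exists$. $\mathsf{NJ} = \mathsf{NM}\cup\{\mathsf{efq}\}$, where $\mathsf{efq}$ infers any $A$ from $\bot$. $\mathsf{NK} = \mathsf{NM}\cup\{\mathsf{raa}\}$, where $\mathsf{raa}$ infers $A$ from a derivation of $\bot$, discharging any number (possibly zero) of assumptions $\lnot A$; an instance of $\mathsf{efq}$ is thus an instance of $\mathsf{raa}$ discharging no assumption, and an instance of $\mathsf{raa}$ is called discharging if it discharges at least one assumption. $\Pi \colon \Gamma \vdash A$ means that $\Pi$ has conclusion $A$ and all its undischarged assumptions are occurrences of formulas in $\Gamma$; $\Gamma \vdash_{\mathsf{D}}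 A$ means such a derivation exists in system $\mathsf{D}$. A derivation is $\mathsf{m}$-standard if it contains at most one instance of $\mathsf{raa}$ and this instance, if any, is its last rule, the rest of the derivation being in $\mathsf{NM}$. A derivation is $\mathsf{j}$-standard if it contains at most one discharging instance of $\mathsf{raa}$ and this instance, if any, is its last rule, the rest being a derivation in $\mathsf{NJ}$ (so it may contain several instances of $\mathsf{efq}$). -}

module Defs where

open import Data.Nat using (ℕ; zero; suc; pred; _<ᵇ_; _≡ᵇ_)
open import Data.Fin using (Fin)
open import Data.Bool using (Bool; true; false; if_then_else_; _∧_; _∨_; not; T)
open import Data.List using (List; []; _∷_; map)
open import Data.Product using (Σ; _×_)
open import Relation.Binary.PropositionalEquality using (_≡_)

record Signature : Set₁ where
  field
    Fun       : Set
    funArity  : Fun → ℕ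
    Pred      : Set
    predArity : Pred → ℕ

module FOL (σ : Signature) where
  open Signature σ

  -- Terms, with variables as de Bruijn indices.
  data Term : Set where
    var : ℕ → Term
    fn  : (f : Fun) → (Fin (funArity f) → Term) → Term

  data Formula : Set where
    atom : (p : Pred) → (Fin (predArity p) → Term) → Formula
    ⊤' ⊥' : Formula
    ¬'_ : Formula → Formula
    _∧'_ _∨'_ _⇒_ : Formula → Formula → Formula
    ∀' ∃' : Formula → Formula

  shiftT : ℕ → Term → Term
  shiftT c (var x)  = var (if x <ᵇ c then x else suc x)
  shiftT c (fn f ts) = fn f (λ i → shiftT c (ts i))

  shiftF : ℕ → Formula → Formula
  shiftF c (atom p ts) = atom p (λ i → shiftT c (ts i))
  shiftF c ⊤' = ⊤'
  shiftF c ⊥' = ⊥'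
  shiftF c (¬' A) = ¬' shiftF c A
  shiftF c (A ∧' B) = shiftF c A ∧' shiftF c B
  shiftF c (A ∨' B) = shiftF c A ∨' shiftF c B
  shiftF c (A ⇒ B) = shiftF c A ⇒ shiftF c B
  shiftF c (∀' A) = ∀' (shiftF (suc c) A)
  shiftF c (∃' A) = ∃' (shiftF (suc c) A)

  ↑ : Formula → Formula
  ↑ = shiftF 0

  substT : ℕ → Term → Term → Term
  substT k s (var x) = if x <ᵇ k then var x else (if x ≡ᵇ k then s else var (pred x))
  substT k s (fn f ts) = fn f (λ i → substT k s (ts i))

  substF : ℕ → Term → Formula → Formula
  substF k s (atom p ts) = atom p (λ i → substT k s (ts i))
  substF k s ⊤' = ⊤'
  substF k s ⊥' = ⊥'
  substF k s (¬' A) = ¬' substF k s A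
  substF k s (A ∧' B) = substF k s A ∧' substF k s B
  substF k s (A ∨' B) = substF k s A ∨' substF k s B
  substF k s (A ⇒ B) = substF k s A ⇒ substF k s B
  substF k s (∀' A) = ∀' (substF (suc k) (shiftT 0 s) A)
  substF k s (∃' A) = ∃' (substF (suc k) (shiftT 0 s) A)

  _[_] : Formula → Term → Formula
  A [ t ] = substF 0 t A

  Ctx : Set₁
  Ctx = Formula → Set

  ↑Ctx : Ctx → Ctx
  ↑Ctx Γ B = Σ Formula (λ C → Γ C × (B ≡ ↑ C))

  data _∋_ : List Formula → Formula → Set where
    here  : ∀ {A Δ} → (A ∷ Δ) ∋ A
    there : ∀ {A B Δ} → Δ ∋ A → (B ∷ Δ) ∋ A

  idx : ∀ {Δ A} → Δ ∋ A → ℕ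
  idx here = zero
  idx (there x) = suc (idx x)

  -- Der Γ Δ A : conclusion A, open assumptions among Γ (never discharged)
  -- and Δ (assumptions that are discharged by enclosing rules; Δ = [] at
  -- top level).  The single rule raa covers both efq (no assumption
  -- discharged) and discharging raa.
  data Der : Ctx → List Formula → Formula → Set₁ where
    hyp  : ∀ {Γ Δ A} → Γ A → Der Γ Δ A
    ass  : ∀ {Γ Δ A} → Δ ∋ A → Der Γ Δ A
    ⊤i   : ∀ {Γ Δ} → Der Γ Δ ⊤'
    ¬i   : ∀ {Γ Δ A} → Der Γ (A ∷ Δ) ⊥' → Der Γ Δ (¬' A)
    ¬e   : ∀ {Γ Δ A} → Der Γ Δ (¬' A) → Der Γ Δ A → Der Γ Δ ⊥'
    ∧i   : ∀ {Γ Δ A B} → Der Γ Δ A → Der Γ Δ B → Der Γ Δ (A ∧' B)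
    ∧e₁  : ∀ {Γ Δ A B} → Der Γ Δ (A ∧' B) → Der Γ Δ A
    ∧e₂  : ∀ {Γ Δ A B} → Der Γ Δ (A ∧' B) → Der Γ Δ B
    ∨i₁  : ∀ {Γ Δ A B} → Der Γ Δ A → Der Γ Δ (A ∨' B)
    ∨i₂  : ∀ {Γ Δ A B} → Der Γ Δ B → Der Γ Δ (A ∨' B)
    ∨e   : ∀ {Γ Δ A B C} → Der Γ Δ (A ∨' B) → Der Γ (A ∷ Δ) C → Der Γ (B ∷ Δ) C → Der Γ Δ C
    ⇒i   : ∀ {Γ Δ A B} → Der Γ (A ∷ Δ) B → Der Γ Δ (A ⇒ B)
    ⇒e   : ∀ {Γ Δ A B} → Der Γ Δ (A ⇒ B) → Der Γ Δ A → Der Γ Δ B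
    ∀i   : ∀ {Γ Δ A} → Der (↑Ctx Γ) (map ↑ Δ) A → Der Γ Δ (∀' A)
    ∀e   : ∀ {Γ Δ A} → Der Γ Δ (∀' A) → (t : Term) → Der Γ Δ (A [ t ])
    ∃i   : ∀ {Γ Δ A} → (t : Term) → Der Γ Δ (A [ t ]) → Der Γ Δ (∃' A)
    ∃e   : ∀ {Γ Δ A C} → Der Γ Δ (∃' A) → Der (↑Ctx Γ) (A ∷ map ↑ Δ) (↑ C) → Der Γ Δ C
    raa  : ∀ {Γ Δ A} → Der Γ ((¬' A) ∷ Δ) ⊥' → Der Γ Δ A

  _⊢NK_ : Ctx → Formula → Set₁
  Γ ⊢NK A = Der Γ [] A

  uses : ∀ {Γ Δ A} → ℕ → Der Γ Δ A → Bool
  uses k (hyp _) = false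
  uses k (ass x) = idx x ≡ᵇ k
  uses k ⊤i = false
  uses k (¬i d) = uses (suc k) d
  uses k (¬e d e) = uses k d ∨ uses k e
  uses k (∧i d e) = uses k d ∨ uses k e
  uses k (∧e₁ d) = uses k d
  uses k (∧e₂ d) = uses k d
  uses k (∨i₁ d) = uses k d
  uses k (∨i₂ d) = uses k d
  uses k (∨e d e f) = uses k d ∨ (uses (suc k) e ∨ uses (suc k) f)
  uses k (⇒i d) = uses (suc k) d
  uses k (⇒e d e) = uses k d ∨ uses k e
  uses k (∀i d) = uses k d
  uses k (∀e d t) = uses k d
  uses k (∃i t d) = uses k d
  uses k (∃e d e) = uses k d ∨ uses (suc k) e
  uses k (raa d) = uses (suc k) d

  discharging : ∀ {Γ Δ A} → Der Γ ((¬' A) ∷ Δ) ⊥' → Bool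
  discharging d = uses zero d

  -- inNM d : d contains no instance of raa (so it is an NM derivation);
  -- inNJ d : every raa instance in d is non-discharging (efq), so d is in NJ.
  inNM inNJ : ∀ {Γ Δ A} → Der Γ Δ A → Bool
  inNM (hyp _) = true
  inNM (ass _) = true
  inNM ⊤i = true
  inNM (¬i d) = inNM d
  inNM (¬e d e) = inNM d ∧ inNM e
  inNM (∧i d e) = inNM d ∧ inNM e
  inNM (∧e₁ d) = inNM d
  inNM (∧e₂ d) = inNM d
  inNM (∨i₁ d) = inNM d
  inNM (∨i₂ d) = inNM d
  inNM (∨e d e f) = inNM d ∧ (inNM e ∧ inNM f)
  inNM (⇒i d) = inNM d
  inNM (⇒e d e) = inNM d ∧ inNM e
  inNM (∀i d) = inNM d
  inNM (∀e d t) = inNM d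
  inNM (∃i t d) = inNM d
  inNM (∃e d e) = inNM d ∧ inNM e
  inNM (raa d) = false

  inNJ (hyp _) = true
  inNJ (ass _) = true
  inNJ ⊤i = true
  inNJ (¬i d) = inNJ d
  inNJ (¬e d e) = inNJ d ∧ inNJ e
  inNJ (∧i d e) = inNJ d ∧ inNJ e
  inNJ (∧e₁ d) = inNJ d
  inNJ (∧e₂ d) = inNJ d
  inNJ (∨i₁ d) = inNJ d
  inNJ (∨i₂ d) = inNJ d
  inNJ (∨e d e f) = inNJ d ∧ (inNJ e ∧ inNJ f)
  inNJ (⇒i d) = inNJ d
  inNJ (⇒e d e) = inNJ d ∧ inNJ e
  inNJ (∀i d) = inNJ d
  inNJ (∀e d t) = inNJ d
  inNJ (∃i t d) = inNJ d
  inNJ (∃e d e) = inNJ d ∧ inNJ e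
  inNJ (raa d) = not (discharging d) ∧ inNJ d

  -- m-standard: at most one raa, and if present it is the last rule,
  -- the rest being in NM.
  mStandard : ∀ {Γ Δ A} → Der Γ Δ A → Set
  mStandard (raa d) = T (inNM d)
  mStandard d = T (inNM d)

  -- j-standard: at most one discharging raa, and if present it is the
  -- last rule, the rest being in NJ.
  jStandard : ∀ {Γ Δ A} → Der Γ Δ A → Set
  jStandard (raa d) = T (inNJ d)
  jStandard d = T (inNJ d)

  noForall noImp : Formula → Bool
  noForall (atom p ts) = true
  noForall ⊤' = true
  noForall ⊥' = true
  noForall (¬' A) = noForall A
  noForall (A ∧' B) = noForall A ∧ noForall B
  noForall (A ∨' B) = noForall A ∧ noForall B
  noForall (A ⇒ B) = noForall A ∧ noForall B
  noForall (∀' A) = false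
  noForall (∃' A) = noForall A

  noImp (atom p ts) = true
  noImp ⊤' = true
  noImp ⊥' = true
  noImp (¬' A) = noImp A
  noImp (A ∧' B) = noImp A ∧ noImp B
  noImp (A ∨' B) = noImp A ∧ noImp B
  noImp (A ⇒ B) = false
  noImp (∀' A) = noImp A
  noImp (∃' A) = noImp A

-- Glivenko's theorem through a negative translation N. An NK derivation of A from Γ is
-- mapped rule by rule to a derivation of N A from Γ in NM, or in NJ once implications occur.
-- N sends a formula of the Glivenko class (∀-free, and for NM also ⇒-free) to its double
-- negation and acts like the Gödel–Gentzen translation elsewhere. Every N A is ¬¬-stable
-- in NM, which is what translates raa; ex falso is needed only to introduce a double-negated
-- implication, via ¬(A ⇒ B) ⊢ ¬¬A. When Γ and A lie in the class this yields an NJ (resp. NM)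
-- proof of ¬¬A from Γ, and one final raa against ¬A is the only discharging instance.
module Submission where

open import Defs
open import Data.Bool using (Bool; true; false; T; if_then_else_; _∧_)
open import Data.Bool.Properties using (if-float; T-∧; T-≡)
open import Data.List using (List; []; _∷_; map)
open import Data.Nat using (suc)
open import Data.Product using (Σ; _×_; _,_; uncurry)
open import Data.Unit using (tt)
open import Function using (_∘_)
open import Function.Bundles using (Equivalence)
open import Relation.Binary.PropositionalEquality
  using (_≡_; refl; sym; cong; cong₂; subst; subst₂; module ≡-Reasoning)

_∧ᵀ_ : ∀ {a b} → T a → T b → T (a ∧ b)
p ∧ᵀ q = Equivalence.from T-∧ (p , q)

T-∧-map : ∀ {a b c d} → (T a → T c) → (T b → T d) → T (a ∧ b) → T (c ∧ d)
T-∧-map f g p = let (pa , pb) = Equivalence.to T-∧ p in f pa ∧ᵀ g pb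

T-∧-map₂ : ∀ {a b c d e f} → (T a → T c → T e) → (T b → T d → T f) →
           T (a ∧ b) → T (c ∧ d) → T (e ∧ f)
T-∧-map₂ f g p q =
  let (pa , pb) = Equivalence.to T-∧ p ; (qc , qd) = Equivalence.to T-∧ q in f pa qc ∧ᵀ g pb qd

data Logic : Set where
  minimal intuitionistic : Logic

hasEfq : Logic → Bool
hasEfq minimal = false
hasEfq intuitionistic = true

module Derivations (σ : Signature) where
  open FOL σ

  variable
    L : Logic
    Γ : Ctx
    Δ Δ' : List Formula
    A B C : Formula

  data Proof (L : Logic) : Ctx → List Formula → Formula → Set₁ where
    hyp  : Γ A → Proof L Γ Δ A
    ass  : Δ ∋ A → Proof L Γ Δ A
    ⊤i   : Proof L Γ Δ ⊤'
    ¬i   : Proof L Γ (A ∷ Δ) ⊥' → Proof L Γ Δ (¬' A)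
    ¬e   : Proof L Γ Δ (¬' A) → Proof L Γ Δ A → Proof L Γ Δ ⊥'
    ∧i   : Proof L Γ Δ A → Proof L Γ Δ B → Proof L Γ Δ (A ∧' B)
    ∧e₁  : Proof L Γ Δ (A ∧' B) → Proof L Γ Δ A
    ∧e₂  : Proof L Γ Δ (A ∧' B) → Proof L Γ Δ B
    ∨i₁  : Proof L Γ Δ A → Proof L Γ Δ (A ∨' B)
    ∨i₂  : Proof L Γ Δ B → Proof L Γ Δ (A ∨' B)
    ∨e   : Proof L Γ Δ (A ∨' B) → Proof L Γ (A ∷ Δ) C → Proof L Γ (B ∷ Δ) C → Proof L Γ Δ C
    ⇒i   : Proof L Γ (A ∷ Δ) B → Proof L Γ Δ (A ⇒ B)
    ⇒e   : Proof L Γ Δ (A ⇒ B) → Proof L Γ Δ A → Proof L Γ Δ B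
    ∀i   : Proof L (↑Ctx Γ) (map ↑ Δ) A → Proof L Γ Δ (∀' A)
    ∀e   : Proof L Γ Δ (∀' A) → (t : Term) → Proof L Γ Δ (A [ t ])
    ∃i   : (t : Term) → Proof L Γ Δ (A [ t ]) → Proof L Γ Δ (∃' A)
    ∃e   : Proof L Γ Δ (∃' A) → Proof L (↑Ctx Γ) (A ∷ map ↑ Δ) (↑ C) → Proof L Γ Δ C
    efq  : T (hasEfq L) → Proof L Γ Δ ⊥' → Proof L Γ Δ A

  toNK : Proof L Γ Δ A → Der Γ Δ A
  toNK (hyp x) = hyp x
  toNK (ass x) = ass x
  toNK ⊤i = ⊤i
  toNK (¬i d) = ¬i (toNK d)
  toNK (¬e d e) = ¬e (toNK d) (toNK e)
  toNK (∧i d e) = ∧i (toNK d) (toNK e)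
  toNK (∧e₁ d) = ∧e₁ (toNK d)
  toNK (∧e₂ d) = ∧e₂ (toNK d)
  toNK (∨i₁ d) = ∨i₁ (toNK d)
  toNK (∨i₂ d) = ∨i₂ (toNK d)
  toNK (∨e d e f) = ∨e (toNK d) (toNK e) (toNK f)
  toNK (⇒i d) = ⇒i (toNK d)
  toNK (⇒e d e) = ⇒e (toNK d) (toNK e)
  toNK (∀i d) = ∀i (toNK d)
  toNK (∀e d t) = ∀e (toNK d) t
  toNK (∃i t d) = ∃i t (toNK d)
  toNK (∃e d e) = ∃e (toNK d) (toNK e)
  -- efq becomes a raa discharging nothing; the ⊥ ⇒ A detour spares a weakening lemma for Der.
  toNK (efq _ d) = ⇒e (⇒i (raa (ass (there here)))) (toNK d)

  toNK-inNJ : (d : Proof L Γ Δ A) → T (inNJ (toNK d))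
  toNK-inNJ (hyp x) = tt
  toNK-inNJ (ass x) = tt
  toNK-inNJ ⊤i = tt
  toNK-inNJ (¬i d) = toNK-inNJ d
  toNK-inNJ (¬e d e) = toNK-inNJ d ∧ᵀ toNK-inNJ e
  toNK-inNJ (∧i d e) = toNK-inNJ d ∧ᵀ toNK-inNJ e
  toNK-inNJ (∧e₁ d) = toNK-inNJ d
  toNK-inNJ (∧e₂ d) = toNK-inNJ d
  toNK-inNJ (∨i₁ d) = toNK-inNJ d
  toNK-inNJ (∨i₂ d) = toNK-inNJ d
  toNK-inNJ (∨e d e f) = toNK-inNJ d ∧ᵀ (toNK-inNJ e ∧ᵀ toNK-inNJ f)
  toNK-inNJ (⇒i d) = toNK-inNJ d
  toNK-inNJ (⇒e d e) = toNK-inNJ d ∧ᵀ toNK-inNJ e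
  toNK-inNJ (∀i d) = toNK-inNJ d
  toNK-inNJ (∀e d t) = toNK-inNJ d
  toNK-inNJ (∃i t d) = toNK-inNJ d
  toNK-inNJ (∃e d e) = toNK-inNJ d ∧ᵀ toNK-inNJ e
  toNK-inNJ (efq _ d) = toNK-inNJ d

  toNK-inNM : (d : Proof minimal Γ Δ A) → T (inNM (toNK d))
  toNK-inNM (hyp x) = tt
  toNK-inNM (ass x) = tt
  toNK-inNM ⊤i = tt
  toNK-inNM (¬i d) = toNK-inNM d
  toNK-inNM (¬e d e) = toNK-inNM d ∧ᵀ toNK-inNM e
  toNK-inNM (∧i d e) = toNK-inNM d ∧ᵀ toNK-inNM e
  toNK-inNM (∧e₁ d) = toNK-inNM d
  toNK-inNM (∧e₂ d) = toNK-inNM d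
  toNK-inNM (∨i₁ d) = toNK-inNM d
  toNK-inNM (∨i₂ d) = toNK-inNM d
  toNK-inNM (∨e d e f) = toNK-inNM d ∧ᵀ (toNK-inNM e ∧ᵀ toNK-inNM f)
  toNK-inNM (⇒i d) = toNK-inNM d
  toNK-inNM (⇒e d e) = toNK-inNM d ∧ᵀ toNK-inNM e
  toNK-inNM (∀i d) = toNK-inNM d
  toNK-inNM (∀e d t) = toNK-inNM d
  toNK-inNM (∃i t d) = toNK-inNM d
  toNK-inNM (∃e d e) = toNK-inNM d ∧ᵀ toNK-inNM e
  toNK-inNM (efq () _)

  Renaming : List Formula → List Formula → Set
  Renaming Δ Δ' = ∀ {A} → Δ ∋ A → Δ' ∋ A

  keep : Renaming Δ Δ' → Renaming (A ∷ Δ) (A ∷ Δ')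
  keep ρ here = here
  keep ρ (there x) = there (ρ x)

  ∋-map : ∀ {f : Formula → Formula} → Δ ∋ A → map f Δ ∋ f A
  ∋-map here = here
  ∋-map (there x) = there (∋-map x)

  map↑ : Renaming Δ Δ' → Renaming (map ↑ Δ) (map ↑ Δ')
  map↑ {Δ = _ ∷ _} ρ here = ∋-map (ρ here)
  map↑ {Δ = _ ∷ _} ρ (there x) = map↑ (ρ ∘ there) x

  rename : Renaming Δ Δ' → Proof L Γ Δ A → Proof L Γ Δ' A
  rename ρ (hyp x) = hyp x
  rename ρ (ass x) = ass (ρ x)
  rename ρ ⊤i = ⊤i
  rename ρ (¬i d) = ¬i (rename (keep ρ) d)
  rename ρ (¬e d e) = ¬e (rename ρ d) (rename ρ e)
  rename ρ (∧i d e) = ∧i (rename ρ d) (rename ρ e)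
  rename ρ (∧e₁ d) = ∧e₁ (rename ρ d)
  rename ρ (∧e₂ d) = ∧e₂ (rename ρ d)
  rename ρ (∨i₁ d) = ∨i₁ (rename ρ d)
  rename ρ (∨i₂ d) = ∨i₂ (rename ρ d)
  rename ρ (∨e d e f) = ∨e (rename ρ d) (rename (keep ρ) e) (rename (keep ρ) f)
  rename ρ (⇒i d) = ⇒i (rename (keep ρ) d)
  rename ρ (⇒e d e) = ⇒e (rename ρ d) (rename ρ e)
  rename ρ (∀i d) = ∀i (rename (map↑ ρ) d)
  rename ρ (∀e d t) = ∀e (rename ρ d) t
  rename ρ (∃i t d) = ∃i t (rename ρ d)
  rename ρ (∃e d e) = ∃e (rename ρ d) (rename (keep (map↑ ρ)) e)
  rename ρ (efq h d) = efq h (rename ρ d)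

  weaken : Proof L Γ Δ A → Proof L Γ (B ∷ Δ) A
  weaken = rename there

  weaken₁ : Proof L Γ (A ∷ Δ) C → Proof L Γ (A ∷ B ∷ Δ) C
  weaken₁ = rename (keep there)

  cut : Proof L Γ (A ∷ Δ) B → Proof L Γ Δ A → Proof L Γ Δ B
  cut d e = ⇒e (⇒i d) e

  ¬¬_ : Formula → Formula
  ¬¬ A = ¬' (¬' A)

  ¬¬i : Proof L Γ Δ A → Proof L Γ Δ (¬¬ A)
  ¬¬i d = ¬i (¬e (ass here) (weaken d))

  ¬¬-bind : Proof L Γ Δ (¬¬ A) → Proof L Γ (A ∷ Δ) (¬¬ B) → Proof L Γ Δ (¬¬ B)
  ¬¬-bind d f = ¬i (¬e (weaken d) (¬i (¬e (weaken₁ f) (ass (there here)))))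

  ¬¬-map : Proof L Γ (A ∷ Δ) B → Proof L Γ Δ (¬¬ A) → Proof L Γ Δ (¬¬ B)
  ¬¬-map f d = ¬¬-bind d (¬¬i f)

  ¬¬-map₂ : Proof L Γ (B ∷ A ∷ Δ) C →
            Proof L Γ Δ (¬¬ A) → Proof L Γ Δ (¬¬ B) → Proof L Γ Δ (¬¬ C)
  ¬¬-map₂ f d e = ¬¬-bind d (¬¬-map f (weaken e))

  ¬¬-∨e : Proof L Γ Δ (¬¬ (A ∨' B)) →
          Proof L Γ (A ∷ Δ) C → Proof L Γ (B ∷ Δ) C → Proof L Γ Δ (¬¬ C)
  ¬¬-∨e d e f = ¬¬-bind d (∨e (ass here) (¬¬i (weaken₁ e)) (¬¬i (weaken₁ f)))

  ¬¬-∃e : Proof L Γ Δ (¬¬ (∃' A)) →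
          Proof L (↑Ctx Γ) (A ∷ map ↑ Δ) (↑ C) → Proof L Γ Δ (¬¬ C)
  ¬¬-∃e d e = ¬¬-bind d (∃e (ass here) (¬¬i (weaken₁ e)))

  ¬¬-⇒i : T (hasEfq L) → Proof L Γ (¬¬ A ∷ Δ) (¬¬ B) → Proof L Γ Δ (¬¬ (A ⇒ B))
  ¬¬-⇒i {L = L} {Γ = Γ} {A = A} {Δ = Δ} {B = B} h d = ¬i (¬e (cut (weaken₁ d) ¬¬A) ¬B)
    where
    ¬¬A : Proof L Γ (¬' (A ⇒ B) ∷ Δ) (¬¬ A)
    ¬¬A = ¬i (¬e (ass (there here)) (⇒i (efq h (¬e (ass (there here)) (ass here)))))
    ¬B : Proof L Γ (¬' (A ⇒ B) ∷ Δ) (¬' B)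
    ¬B = ¬i (¬e (ass (there here)) (⇒i (ass (there here))))

  ¬-stable : Proof L Γ Δ (¬¬ (¬' A)) → Proof L Γ Δ (¬' A)
  ¬-stable d = ¬i (¬e (weaken d) (¬¬i (ass here)))

  ⊥-stable : Proof L Γ Δ (¬¬ ⊥') → Proof L Γ Δ ⊥'
  ⊥-stable d = ¬e d (¬i (ass here))

  strengthen-¬¬-head : Proof L Γ (¬¬ A ∷ Δ) B → Proof L Γ (A ∷ Δ) B
  strengthen-¬¬-head d = cut (weaken₁ d) (¬¬i (ass here))

  ¬i-¬¬ : Proof L Γ (¬¬ A ∷ Δ) (¬¬ ⊥') → Proof L Γ Δ (¬' A)
  ¬i-¬¬ d = ¬i (⊥-stable (strengthen-¬¬-head d))

  raa-¬¬ : Proof L Γ Δ (¬¬ A) → Der Γ Δ A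
  raa-¬¬ d = raa (toNK (¬e (weaken d) (ass here)))

  ¬¬⇒jStandard : Proof L Γ [] (¬¬ A) → Σ (Der Γ [] A) jStandard
  ¬¬⇒jStandard d = raa-¬¬ d , toNK-inNJ (¬e (weaken d) (ass here))

  ¬¬⇒mStandard : Proof minimal Γ [] (¬¬ A) → Σ (Der Γ [] A) mStandard
  ¬¬⇒mStandard d = raa-¬¬ d , toNK-inNM (¬e (weaken d) (ass here))

module Translation (σ : Signature) (L : Logic) where
  open FOL σ
  open Derivations σ hiding (L)

  -- ∀ is excluded since ¬¬∀x A ⊢ ∀x ¬¬A has no converse; ⇒ needs efq for ¬(A ⇒ B) ⊢ ¬¬A.
  glivenko : Formula → Bool
  glivenko (atom p ts) = true
  glivenko ⊤' = true
  glivenko ⊥' = true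
  glivenko (¬' A) = glivenko A
  glivenko (A ∧' B) = glivenko A ∧ glivenko B
  glivenko (A ∨' B) = glivenko A ∧ glivenko B
  glivenko (A ⇒ B) = hasEfq L ∧ (glivenko A ∧ glivenko B)
  glivenko (∀' A) = false
  glivenko (∃' A) = glivenko A

  N hom : Formula → Formula
  N A = if glivenko A then ¬¬ A else hom A
  hom (atom p ts) = ¬¬ (atom p ts)
  hom ⊤' = ⊤'
  hom ⊥' = ⊥'
  hom (¬' A) = ¬' N A
  hom (A ∧' B) = N A ∧' N B
  hom (A ∨' B) = ¬¬ (N A ∨' N B)
  hom (A ⇒ B) = N A ⇒ N B
  hom (∀' A) = ¬¬ (∀' (N A))
  hom (∃' A) = ¬¬ (∃' (N A))

  glivenko-shiftF : ∀ c A → glivenko (shiftF c A) ≡ glivenko A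
  glivenko-shiftF c (atom p ts) = refl
  glivenko-shiftF c ⊤' = refl
  glivenko-shiftF c ⊥' = refl
  glivenko-shiftF c (¬' A) = glivenko-shiftF c A
  glivenko-shiftF c (A ∧' B) = cong₂ _∧_ (glivenko-shiftF c A) (glivenko-shiftF c B)
  glivenko-shiftF c (A ∨' B) = cong₂ _∧_ (glivenko-shiftF c A) (glivenko-shiftF c B)
  glivenko-shiftF c (A ⇒ B) =
    cong (hasEfq L ∧_) (cong₂ _∧_ (glivenko-shiftF c A) (glivenko-shiftF c B))
  glivenko-shiftF c (∀' A) = refl
  glivenko-shiftF c (∃' A) = glivenko-shiftF (suc c) A

  glivenko-substF : ∀ k s A → glivenko (substF k s A) ≡ glivenko A
  glivenko-substF k s (atom p ts) = refl
  glivenko-substF k s ⊤' = refl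
  glivenko-substF k s ⊥' = refl
  glivenko-substF k s (¬' A) = glivenko-substF k s A
  glivenko-substF k s (A ∧' B) = cong₂ _∧_ (glivenko-substF k s A) (glivenko-substF k s B)
  glivenko-substF k s (A ∨' B) = cong₂ _∧_ (glivenko-substF k s A) (glivenko-substF k s B)
  glivenko-substF k s (A ⇒ B) =
    cong (hasEfq L ∧_) (cong₂ _∧_ (glivenko-substF k s A) (glivenko-substF k s B))
  glivenko-substF k s (∀' A) = refl
  glivenko-substF k s (∃' A) = glivenko-substF (suc k) (shiftT 0 s) A

  N-shiftF : ∀ c A → shiftF c (N A) ≡ N (shiftF c A)
  hom-shiftF : ∀ c A → shiftF c (hom A) ≡ hom (shiftF c A)
  N-shiftF c A = begin
    shiftF c (if glivenko A then ¬¬ A else hom A)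
      ≡⟨ if-float (shiftF c) (glivenko A) ⟩
    (if glivenko A then ¬¬ shiftF c A else shiftF c (hom A))
      ≡⟨ cong₂ (if_then ¬¬ shiftF c A else_) (sym (glivenko-shiftF c A)) (hom-shiftF c A) ⟩
    N (shiftF c A) ∎
    where open ≡-Reasoning
  hom-shiftF c (atom p ts) = refl
  hom-shiftF c ⊤' = refl
  hom-shiftF c ⊥' = refl
  hom-shiftF c (¬' A) = cong ¬'_ (N-shiftF c A)
  hom-shiftF c (A ∧' B) = cong₂ _∧'_ (N-shiftF c A) (N-shiftF c B)
  hom-shiftF c (A ∨' B) = cong₂ (λ X Y → ¬¬ (X ∨' Y)) (N-shiftF c A) (N-shiftF c B)
  hom-shiftF c (A ⇒ B) = cong₂ _⇒_ (N-shiftF c A) (N-shiftF c B)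
  hom-shiftF c (∀' A) = cong (¬¬_ ∘ ∀') (N-shiftF (suc c) A)
  hom-shiftF c (∃' A) = cong (¬¬_ ∘ ∃') (N-shiftF (suc c) A)

  N-substF : ∀ k s A → substF k s (N A) ≡ N (substF k s A)
  hom-substF : ∀ k s A → substF k s (hom A) ≡ hom (substF k s A)
  N-substF k s A = begin
    substF k s (if glivenko A then ¬¬ A else hom A)
      ≡⟨ if-float (substF k s) (glivenko A) ⟩
    (if glivenko A then ¬¬ substF k s A else substF k s (hom A))
      ≡⟨ cong₂ (if_then ¬¬ substF k s A else_) (sym (glivenko-substF k s A)) (hom-substF k s A) ⟩
    N (substF k s A) ∎
    where open ≡-Reasoning
  hom-substF k s (atom p ts) = refl
  hom-substF k s ⊤' = refl
  hom-substF k s ⊥' = refl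
  hom-substF k s (¬' A) = cong ¬'_ (N-substF k s A)
  hom-substF k s (A ∧' B) = cong₂ _∧'_ (N-substF k s A) (N-substF k s B)
  hom-substF k s (A ∨' B) = cong₂ (λ X Y → ¬¬ (X ∨' Y)) (N-substF k s A) (N-substF k s B)
  hom-substF k s (A ⇒ B) = cong₂ _⇒_ (N-substF k s A) (N-substF k s B)
  hom-substF k s (∀' A) = cong (¬¬_ ∘ ∀') (N-substF (suc k) (shiftT 0 s) A)
  hom-substF k s (∃' A) = cong (¬¬_ ∘ ∃') (N-substF (suc k) (shiftT 0 s) A)

  N-map-↑ : ∀ Δ → map N (map ↑ Δ) ≡ map ↑ (map N Δ)
  N-map-↑ [] = refl
  N-map-↑ (A ∷ Δ) = cong₂ _∷_ (sym (N-shiftF 0 A)) (N-map-↑ Δ)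

  N-stable : ∀ A → Proof L Γ Δ (¬¬ N A) → Proof L Γ Δ (N A)
  hom-stable : ∀ A → Proof L Γ Δ (¬¬ hom A) → Proof L Γ Δ (hom A)
  N-stable A d with glivenko A
  ... | true = ¬-stable d
  ... | false = hom-stable A d
  hom-stable (atom p ts) = ¬-stable
  hom-stable ⊤' _ = ⊤i
  hom-stable ⊥' = ⊥-stable
  hom-stable (¬' A) = ¬-stable
  hom-stable (A ∧' B) d =
    ∧i (N-stable A (¬¬-map (∧e₁ (ass here)) d)) (N-stable B (¬¬-map (∧e₂ (ass here)) d))
  hom-stable (A ∨' B) = ¬-stable
  hom-stable (A ⇒ B) d = ⇒i (N-stable B (¬¬-map (⇒e (ass here) (ass (there here))) (weaken d)))
  hom-stable (∀' A) = ¬-stable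
  hom-stable (∃' A) = ¬-stable

  N-intro : T (glivenko A) → Proof L Γ Δ A → Proof L Γ Δ (N A)
  N-intro {A = A} g d with glivenko A
  ... | true = ¬¬i d

  N-elim : T (glivenko A) → Proof L Γ Δ (N A) → Proof L Γ Δ (¬¬ A)
  N-elim {A = A} g d with glivenko A
  ... | true = d

  N¬i : Proof L Γ (N A ∷ Δ) (N ⊥') → Proof L Γ Δ (N (¬' A))
  N¬i {A = A} d with glivenko A
  ... | true = ¬¬i (¬i-¬¬ d)
  ... | false = ¬i (⊥-stable d)

  N¬e : Proof L Γ Δ (N (¬' A)) → Proof L Γ Δ (N A) → Proof L Γ Δ (N ⊥')
  N¬e {A = A} d e with glivenko A
  ... | true = ¬¬i (¬e d e)
  ... | false = ¬¬i (¬e d e)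

  N∧i : Proof L Γ Δ (N A) → Proof L Γ Δ (N B) → Proof L Γ Δ (N (A ∧' B))
  N∧i {A = A} {B = B} d e with glivenko A | glivenko B
  ... | true | true = ¬¬-map₂ (∧i (ass (there here)) (ass here)) d e
  ... | true | false = ∧i d e
  ... | false | _ = ∧i d e

  N∧e₁ : Proof L Γ Δ (N (A ∧' B)) → Proof L Γ Δ (N A)
  N∧e₁ {A = A} {B = B} d with glivenko A | glivenko B
  ... | true | true = ¬¬-map (∧e₁ (ass here)) d
  ... | true | false = ∧e₁ d
  ... | false | _ = ∧e₁ d

  N∧e₂ : Proof L Γ Δ (N (A ∧' B)) → Proof L Γ Δ (N B)
  N∧e₂ {A = A} {B = B} d with glivenko A | glivenko B
  ... | true | true = ¬¬-map (∧e₂ (ass here)) d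
  ... | true | false = ∧e₂ d
  ... | false | _ = ∧e₂ d

  N∨i₁ : Proof L Γ Δ (N A) → Proof L Γ Δ (N (A ∨' B))
  N∨i₁ {A = A} {B = B} d with glivenko A | glivenko B
  ... | true | true = ¬¬-map (∨i₁ (ass here)) d
  ... | true | false = ¬¬i (∨i₁ d)
  ... | false | _ = ¬¬i (∨i₁ d)

  N∨i₂ : Proof L Γ Δ (N B) → Proof L Γ Δ (N (A ∨' B))
  N∨i₂ {B = B} {A = A} d with glivenko A | glivenko B
  ... | true | true = ¬¬-map (∨i₂ (ass here)) d
  ... | true | false = ¬¬i (∨i₂ d)
  ... | false | _ = ¬¬i (∨i₂ d)

  N∨e : Proof L Γ Δ (N (A ∨' B)) →
        Proof L Γ (N A ∷ Δ) (N C) → Proof L Γ (N B ∷ Δ) (N C) → Proof L Γ Δ (N C)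
  N∨e {A = A} {B = B} {C = C} d e f = N-stable C (cases d e f)
    where
    cases : Proof L Γ Δ (N (A ∨' B)) →
            Proof L Γ (N A ∷ Δ) (N C) → Proof L Γ (N B ∷ Δ) (N C) → Proof L Γ Δ (¬¬ N C)
    cases d e f with glivenko A | glivenko B
    ... | true | true = ¬¬-∨e d (strengthen-¬¬-head e) (strengthen-¬¬-head f)
    ... | true | false = ¬¬-∨e d e f
    ... | false | _ = ¬¬-∨e d e f

  N⇒i : Proof L Γ (N A ∷ Δ) (N B) → Proof L Γ Δ (N (A ⇒ B))
  N⇒i {A = A} {B = B} d with hasEfq L in efq? | glivenko A | glivenko B
  ... | true | true | true = ¬¬-⇒i (Equivalence.from T-≡ efq?) d
  ... | true | true | false = ⇒i d
  ... | true | false | _ = ⇒i d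
  ... | false | _ | _ = ⇒i d

  N⇒e : Proof L Γ Δ (N (A ⇒ B)) → Proof L Γ Δ (N A) → Proof L Γ Δ (N B)
  N⇒e {A = A} {B = B} d e with hasEfq L | glivenko A | glivenko B
  ... | true | true | true = ¬¬-map₂ (⇒e (ass (there here)) (ass here)) d e
  ... | true | true | false = ⇒e d e
  ... | true | false | _ = ⇒e d e
  ... | false | _ | _ = ⇒e d e

  N∀i : Proof L (↑Ctx Γ) (map ↑ Δ) (N A) → Proof L Γ Δ (N (∀' A))
  N∀i d = ¬¬i (∀i d)

  N∀e : ∀ t → Proof L Γ Δ (N (∀' A)) → Proof L Γ Δ (N (A [ t ]))
  N∀e {A = A} t d = N-stable (A [ t ])
    (subst (Proof L _ _ ∘ ¬¬_) (N-substF 0 t A) (¬¬-map (∀e (ass here) t) d))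

  N∃i : ∀ t → Proof L Γ Δ (N (A [ t ])) → Proof L Γ Δ (N (∃' A))
  N∃i {A = A} t d = intro (subst (Proof L _ _) (sym (N-substF 0 t A)) d)
    where
    intro : Proof L Γ Δ (N A [ t ]) → Proof L Γ Δ (N (∃' A))
    intro d with glivenko A
    ... | true = ¬¬-map (∃i t (ass here)) d
    ... | false = ¬¬i (∃i t d)

  N∃e : Proof L Γ Δ (N (∃' A)) →
        Proof L (↑Ctx Γ) (N A ∷ map ↑ Δ) (↑ (N C)) → Proof L Γ Δ (N C)
  N∃e {A = A} {C = C} d e = N-stable C (elim d e)
    where
    elim : Proof L Γ Δ (N (∃' A)) →
           Proof L (↑Ctx Γ) (N A ∷ map ↑ Δ) (↑ (N C)) → Proof L Γ Δ (¬¬ N C)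
    elim d e with glivenko A
    ... | true = ¬¬-∃e d (strengthen-¬¬-head e)
    ... | false = ¬¬-∃e d e

  N-raa : Proof L Γ (N (¬' A) ∷ Δ) (N ⊥') → Proof L Γ Δ (N A)
  N-raa {A = A} d with glivenko A
  ... | true = ¬i-¬¬ d
  ... | false = hom-stable A (¬i (⊥-stable d))

  GlivenkoCtx : Ctx → Set
  GlivenkoCtx Γ = ∀ B → Γ B → T (glivenko B)

  GlivenkoCtx-↑ : GlivenkoCtx Γ → GlivenkoCtx (↑Ctx Γ)
  GlivenkoCtx-↑ g _ (C , c , refl) = subst T (sym (glivenko-shiftF 0 C)) (g C c)

  translate : GlivenkoCtx Γ → Der Γ Δ A → Proof L Γ (map N Δ) (N A)
  translate g (hyp x) = N-intro (g _ x) (hyp x)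
  translate g (ass x) = ass (∋-map x)
  translate g ⊤i = ¬¬i ⊤i
  translate g (¬i d) = N¬i (translate g d)
  translate g (¬e d e) = N¬e (translate g d) (translate g e)
  translate g (∧i d e) = N∧i (translate g d) (translate g e)
  translate g (∧e₁ d) = N∧e₁ (translate g d)
  translate g (∧e₂ d) = N∧e₂ (translate g d)
  translate g (∨i₁ d) = N∨i₁ (translate g d)
  translate g (∨i₂ d) = N∨i₂ (translate g d)
  translate g (∨e {A = A} {B = B} {C = C} d e f) =
    N∨e {A = A} {B = B} {C = C} (translate g d) (translate g e) (translate g f)
  translate g (⇒i d) = N⇒i (translate g d)
  translate g (⇒e d e) = N⇒e (translate g d) (translate g e)
  translate {Δ = Δ} g (∀i {A = A} d) =
    N∀i {A = A} (subst (λ Δ' → Proof L _ Δ' _) (N-map-↑ Δ) (translate (GlivenkoCtx-↑ g) d))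
  translate g (∀e {A = A} d t) = N∀e {A = A} t (translate g d)
  translate g (∃i t d) = N∃i t (translate g d)
  translate {Δ = Δ} g (∃e {A = A} {C = C} d e) =
    N∃e {A = A} {C = C} (translate g d)
      (subst₂ (Proof L _) (cong (N A ∷_) (N-map-↑ Δ)) (sym (N-shiftF 0 C))
        (translate (GlivenkoCtx-↑ g) e))
  translate g (raa d) = N-raa (translate g d)

  glivenko-theorem : GlivenkoCtx Γ → T (glivenko A) → Γ ⊢NK A → Proof L Γ [] (¬¬ A)
  glivenko-theorem gΓ gA d = N-elim gA (translate gΓ d)

module _ (σ : Signature) where
  open FOL σ
  private
    module J = Translation σ intuitionistic
    module M = Translation σ minimal

  noForall⇒glivenkoᴶ : ∀ A → T (noForall A) → T (J.glivenko A)
  noForall⇒glivenkoᴶ (atom p ts) _ = tt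
  noForall⇒glivenkoᴶ ⊤' _ = tt
  noForall⇒glivenkoᴶ ⊥' _ = tt
  noForall⇒glivenkoᴶ (¬' A) = noForall⇒glivenkoᴶ A
  noForall⇒glivenkoᴶ (A ∧' B) = T-∧-map (noForall⇒glivenkoᴶ A) (noForall⇒glivenkoᴶ B)
  noForall⇒glivenkoᴶ (A ∨' B) = T-∧-map (noForall⇒glivenkoᴶ A) (noForall⇒glivenkoᴶ B)
  noForall⇒glivenkoᴶ (A ⇒ B) = T-∧-map (noForall⇒glivenkoᴶ A) (noForall⇒glivenkoᴶ B)
  noForall⇒glivenkoᴶ (∀' A) ()
  noForall⇒glivenkoᴶ (∃' A) = noForall⇒glivenkoᴶ A

  noForall∧noImp⇒glivenkoᴹ : ∀ A → T (noForall A) → T (noImp A) → T (M.glivenko A)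
  noForall∧noImp⇒glivenkoᴹ (atom p ts) _ _ = tt
  noForall∧noImp⇒glivenkoᴹ ⊤' _ _ = tt
  noForall∧noImp⇒glivenkoᴹ ⊥' _ _ = tt
  noForall∧noImp⇒glivenkoᴹ (¬' A) = noForall∧noImp⇒glivenkoᴹ A
  noForall∧noImp⇒glivenkoᴹ (A ∧' B) =
    T-∧-map₂ (noForall∧noImp⇒glivenkoᴹ A) (noForall∧noImp⇒glivenkoᴹ B)
  noForall∧noImp⇒glivenkoᴹ (A ∨' B) =
    T-∧-map₂ (noForall∧noImp⇒glivenkoᴹ A) (noForall∧noImp⇒glivenkoᴹ B)
  noForall∧noImp⇒glivenkoᴹ (A ⇒ B) _ ()
  noForall∧noImp⇒glivenkoᴹ (∀' A) ()
  noForall∧noImp⇒glivenkoᴹ (∃' A) = noForall∧noImp⇒glivenkoᴹ A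

corollary5p4 : (σ : Signature) → let open FOL σ in
    (Γ : Ctx) (A : Formula) → Γ ⊢NK A →
      (((B : Formula) → Γ B → T (noForall B)) → T (noForall A) →
        Σ (Der Γ [] A) jStandard)
    × (((B : Formula) → Γ B → T (noForall B) × T (noImp B)) → T (noForall A) → T (noImp A) →
        Σ (Der Γ [] A) mStandard)
corollary5p4 σ Γ A d =
    (λ fΓ fA → ¬¬⇒jStandard
      (J.glivenko-theorem (λ B → noForall⇒glivenkoᴶ σ B ∘ fΓ B)
        (noForall⇒glivenkoᴶ σ A fA) d))
  , (λ fiΓ fA iA → ¬¬⇒mStandard
      (M.glivenko-theorem (λ B → uncurry (noForall∧noImp⇒glivenkoᴹ σ B) ∘ fiΓ B)
        (noForall∧noImp⇒glivenkoᴹ σ A fA iA) d))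
  where
  open Derivations σ using (¬¬⇒jStandard; ¬¬⇒mStandard)
  module J = Translation σ intuitionistic
  module M = Translation σ minimal
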